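{- For any graph $G$ of order $n$, \[ 1\leqslant (\chi_2(G)\chi_2(\overline{G}))^{1/2}\leqslant \frac{\chi_2(G)+\chi_2(\overline{G})}{2}\leqslant \frac{n+1}{2}. \]
   Context: All graphs are finite and simple; the order of a graph is its number of vertices, and $\overline{G}$ denotes the complement of $G$ (same vertex set, $uv$ an edge of $\overline{G}$ iff $uv$ is not an edge of $G$). For a graph $G$, $d(u,v)$ is the length of a shortest $(u,v)$-path in $G$. A mapping $f:V(G)\to\{1,\ldots,k\}$ is a 2-proper $k$-coloring of $G$ if $f(u)\neq f(v)$ whenever $d(u,v)=2$ (adjacent vertices may receive the same color). The 2-proper chromatic number $\chi_2(G)$ is the minimum $k$ such that $G$ has a 2-proper $k$-coloring. -}

module Defs where

open import Data.Nat using (ℕ; zero; suc; _<_)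
open import Data.Fin using (Fin; _≟_)
open import Data.Bool using (Bool; true; false; not; T)
open import Data.Product using (_×_)
open import Relation.Nullary using (¬_; does)
open import Relation.Binary.PropositionalEquality using (_≡_; refl; cong; sym)
open import Relation.Nullary using (yes; no)
open import Data.Empty using (⊥-elim)
open import Data.Product using (Σ)

record Graph (n : ℕ) : Set where
  field
    adj   : Fin n → Fin n → Bool
    adj-sym   : ∀ u v → adj u v ≡ adj v u
    adj-irrefl : ∀ u → adj u u ≡ false
open Graph public

Edge : ∀ {n} → Graph n → Fin n → Fin n → Set
Edge G u v = T (adj G u v)

complement : ∀ {n} → Graph n → Graph n
complement {n} G = record { adj = a ; adj-sym = s ; adj-irrefl = i }
  where
  a : Fin n → Fin n → Bool
  a u v with u ≟ v
  ... | yes _ = false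
  ... | no  _ = not (adj G u v)
  s : ∀ u v → a u v ≡ a v u
  s u v with u ≟ v | v ≟ u
  ... | yes _ | yes _ = refl
  ... | yes p | no ¬q = ⊥-elim (¬q (sym p))
  ... | no ¬p | yes q = ⊥-elim (¬p (sym q))
  ... | no _  | no _  = cong not (adj-sym G u v)
  i : ∀ u → a u u ≡ false
  i u with u ≟ u
  ... | yes _ = refl
  ... | no ¬p = ⊥-elim (¬p refl)

data Walk {n : ℕ} (G : Graph n) : Fin n → Fin n → ℕ → Set where
  [] : ∀ {u} → Walk G u u zero
  _∷_ : ∀ {u w v ℓ} → Edge G u w → Walk G w v ℓ → Walk G u v (suc ℓ)

-- d(u,v) = d : the length of a shortest (u,v)-path (equivalently walk) is d.
Dist : ∀ {n} → Graph n → Fin n → Fin n → ℕ → Set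
Dist G u v d = Walk G u v d × (∀ m → m < d → ¬ Walk G u v m)

TwoProper : ∀ {n} → Graph n → (k : ℕ) → (Fin n → Fin k) → Set
TwoProper G k f = ∀ u v → Dist G u v 2 → ¬ (f u ≡ f v)

HasTwoProperColoring : ∀ {n} → Graph n → ℕ → Set
HasTwoProperColoring {n} G k = Σ (Fin n → Fin k) (TwoProper G k)

IsChi2 : ∀ {n} → Graph n → ℕ → Set
IsChi2 G k = HasTwoProperColoring G k × (∀ j → j < k → ¬ HasTwoProperColoring G j)

module Submission where

-- For ordinary (conflict) colourings this is the
-- Nordhaus–Gaddum bound: for every symmetric relation r on n ≥ 0 points
-- there are a proper colouring of r with p colours and a proper colouring of
-- its complement with q colours such that p + q ≤ n + 1.  It is proved by
-- induction on n: removing vertex 0, either one of the two colourings has a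
-- colour unused on the neighbourhood of vertex 0 (reuse it there, and give
-- vertex 0 a fresh colour in the other colouring), or every colour of the
-- first colouring occurs among the r-neighbours of vertex 0 and every colour
-- of the second among its non-neighbours, so p + q ≤ n by counting.
--
-- Vertices at distance 2 are distinct and non-adjacent.  Hence a proper
-- colouring of the non-adjacency relation of G is 2-proper for G, and a
-- proper colouring of the adjacency relation of G is 2-proper for Ḡ.  Applied
-- to r = adjacency of G this gives χ₂(G) + χ₂(Ḡ) ≤ n + 1.  The remaining
-- inequalities are 1 ≤ χ₂(G)χ₂(Ḡ) (a non-empty graph needs a colour) and
-- the arithmetic–geometric mean inequality 4ab ≤ (a + b)², squared.

open import Defs
open import Data.Nat using (ℕ; zero; suc; _+_; _*_; _∸_; _≤_; _≤?_; z≤n; s≤s)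
open import Data.Nat.Properties
  using (+-suc; +-comm; *-comm; ≤-trans; ≤-total; +-mono-≤; *-mono-≤; m≤m+n; m+[n∸m]≡n; ≰⇒>)
open import Data.Nat.Tactic.RingSolver using (solve-∀)
open import Data.Fin using (Fin; zero; suc; fromℕ; inject₁; splitAt; join; _≟_)
open import Data.Fin.Properties
  using (any?; all?; ¬∀⟶∃¬; injective⇒≤; fromℕ≢inject₁; inject₁-injective; join-splitAt)
open import Data.Bool using (Bool; true; false; not; T)
open import Data.Unit using (tt)
open import Data.Product using (Σ; _×_; _,_; proj₁; proj₂)
open import Data.Sum using (_⊎_; inj₁; inj₂; [_,_]′)
open import Data.Empty using (⊥-elim)
open import Function.Definitions using (Injective)
open import Relation.Nullary using (¬_; yes; no; Dec)
open import Relation.Nullary.Decidable using (T?; _→-dec_; ¬?)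
open import Relation.Binary.PropositionalEquality
  using (_≡_; _≢_; refl; sym; trans; cong; subst; subst₂)

Rel : ℕ → Set
Rel n = Fin n → Fin n → Bool

-- Graph-like relations are symmetric; this lets vertex 0 be treated on both sides.
Symmetric : ∀ {n} → Rel n → Set
Symmetric r = ∀ u v → r u v ≡ r v u

co : ∀ {n} → Rel n → Rel n
co r u v = not (r u v)

co-symmetric : ∀ {n} {r : Rel n} → Symmetric r → Symmetric (co r)
co-symmetric r-sym u v = cong not (r-sym u v)

restrict : ∀ {n} → Rel (suc n) → Rel n
restrict r u v = r (suc u) (suc v)

Proper : ∀ {n} → Rel n → (k : ℕ) → (Fin n → Fin k) → Set
Proper r k f = ∀ u v → u ≢ v → T (r u v) → f u ≢ f v

T-not-contradiction : ∀ b → T b → ¬ T (not b)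
T-not-contradiction true _ ()

¬T⇒T-not : ∀ b → ¬ T b → T (not b)
¬T⇒T-not true ¬t = ¬t tt
¬T⇒T-not false _ = tt

¬T-not⇒T : ∀ b → ¬ T (not b) → T b
¬T-not⇒T true _ = tt
¬T-not⇒T false ¬t = ¬t tt

withFresh : ∀ {n k} → (Fin n → Fin k) → Fin (suc n) → Fin (suc k)
withFresh {k = k} f zero = fromℕ k
withFresh f (suc w) = inject₁ (f w)

withFresh-proper : ∀ {n k} (r : Rel (suc n)) (f : Fin n → Fin k) →
  Proper (restrict r) k f → Proper r (suc k) (withFresh f)
withFresh-proper r f f-proper zero    zero    0≢0 _ _ = 0≢0 refl
withFresh-proper r f f-proper zero    (suc v) _   _ e = fromℕ≢inject₁ e
withFresh-proper r f f-proper (suc u) zero    _   _ e = fromℕ≢inject₁ (sym e)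
withFresh-proper r f f-proper (suc u) (suc v) u≢v t e =
  f-proper u v (λ u≡v → u≢v (cong suc u≡v)) t (inject₁-injective e)

withColour : ∀ {n k} → (Fin n → Fin k) → Fin k → Fin (suc n) → Fin k
withColour f c zero = c
withColour f c (suc w) = f w

Avoids : ∀ {n k} → Rel (suc n) → (Fin n → Fin k) → Fin k → Fin n → Set
Avoids r f c w = T (r zero (suc w)) → f w ≢ c

-- Avoiding is decidable, which makes the dichotomy below constructive.
avoids? : ∀ {n k} (r : Rel (suc n)) (f : Fin n → Fin k) c w → Dec (Avoids r f c w)
avoids? r f c w = T? (r zero (suc w)) →-dec ¬? (f w ≟ c)

Free : ∀ {n k} → Rel (suc n) → (Fin n → Fin k) → Fin k → Set
Free r f c = ∀ w → Avoids r f c w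

withColour-proper : ∀ {n k} (r : Rel (suc n)) → Symmetric r → (f : Fin n → Fin k) →
  Proper (restrict r) k f → (c : Fin k) → Free r f c → Proper r k (withColour f c)
withColour-proper r r-sym f f-proper c free zero    zero    0≢0 _ _ = 0≢0 refl
withColour-proper r r-sym f f-proper c free zero    (suc v) _   t e = free v t (sym e)
withColour-proper r r-sym f f-proper c free (suc u) zero    _   t e =
  free u (subst T (r-sym (suc u) zero) t) e
withColour-proper r r-sym f f-proper c free (suc u) (suc v) u≢v t e =
  f-proper u v (λ u≡v → u≢v (cong suc u≡v)) t e

Used : ∀ {n k} → Rel (suc n) → (Fin n → Fin k) → Fin k → Set
Used {n} r f c = Σ (Fin n) λ w → T (r zero (suc w)) × f w ≡ c

-- A colour that is not free is used (the neighbourhood is finite and decidable).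
¬Free⇒Used : ∀ {n k} (r : Rel (suc n)) (f : Fin n → Fin k) c → ¬ Free r f c → Used r f c
¬Free⇒Used {n} r f c ¬free with ¬∀⟶∃¬ n (Avoids r f c) (avoids? r f c) ¬free
... | w , ¬avoids with T? (r zero (suc w)) | f w ≟ c
...   | yes t | yes e  = w , t , e
...   | yes _ | no f≢c = ⊥-elim (¬avoids (λ _ → f≢c))
...   | no ¬t | _      = ⊥-elim (¬avoids (λ t → ⊥-elim (¬t t)))

free-or-allUsed : ∀ {n k} (r : Rel (suc n)) (f : Fin n → Fin k) →
  Σ (Fin k) (Free r f) ⊎ (∀ c → Used r f c)
free-or-allUsed r f with any? (λ c → all? (avoids? r f c))
... | yes free = inj₁ free
... | no ¬free = inj₂ λ c → ¬Free⇒Used r f c (λ free → ¬free (c , free))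

section-injective : ∀ {A B : Set} (f : A → B) (w : B → A) →
  (∀ c → f (w c) ≡ c) → Injective _≡_ _≡_ w
section-injective f w fw {x} {y} e = trans (sym (fw x)) (trans (cong f e) (fw y))

disjoint-injections⇒≤ : ∀ {p q m} (i : Fin p → Fin m) (j : Fin q → Fin m) →
  Injective _≡_ _≡_ i → Injective _≡_ _≡_ j → (∀ x y → i x ≢ j y) → p + q ≤ m
disjoint-injections⇒≤ {p} {q} i j i-inj j-inj disjoint =
  injective⇒≤ {f = λ x → [ i , j ]′ (splitAt p x)} (λ e → splitAt-injective (copair-injective e))
  where
  copair-injective : Injective _≡_ _≡_ [ i , j ]′
  copair-injective {inj₁ x} {inj₁ y} e = cong inj₁ (i-inj e)
  copair-injective {inj₂ x} {inj₂ y} e = cong inj₂ (j-inj e)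
  copair-injective {inj₁ x} {inj₂ y} e = ⊥-elim (disjoint x y e)
  copair-injective {inj₂ x} {inj₁ y} e = ⊥-elim (disjoint y x (sym e))
  splitAt-injective : Injective _≡_ _≡_ (splitAt p {q})
  splitAt-injective {x} {y} e =
    trans (sym (join-splitAt p q x)) (trans (cong (join p q) e) (join-splitAt p q y))

-- If every colour of f is used on the r-neighbours of vertex 0 and every
-- colour of g on its non-neighbours, choosing one such vertex per colour
-- injects Fin p ⊎ Fin q into the n other vertices.
allUsed⇒≤ : ∀ {n p q} (r : Rel (suc n)) (f : Fin n → Fin p) (g : Fin n → Fin q) →
  (∀ c → Used r f c) → (∀ d → Used (co r) g d) → p + q ≤ n
allUsed⇒≤ {n} {p} {q} r f g usedF usedG = disjoint-injections⇒≤ witnessF witnessG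
  (section-injective f witnessF (λ c → proj₂ (proj₂ (usedF c))))
  (section-injective g witnessG (λ d → proj₂ (proj₂ (usedG d))))
  disjoint
  where
  witnessF : Fin p → Fin n
  witnessF c = proj₁ (usedF c)
  witnessG : Fin q → Fin n
  witnessG d = proj₁ (usedG d)
  disjoint : ∀ c d → witnessF c ≢ witnessG d
  disjoint c d e = T-not-contradiction _ (proj₁ (proj₂ (usedF c)))
    (subst (λ w → T (not (r zero (suc w)))) (sym e) (proj₁ (proj₂ (usedG d))))

record ColouringPair {n : ℕ} (r : Rel n) : Set where
  constructor colourings
  field
    p q      : ℕ
    f        : Fin n → Fin p
    f-proper : Proper r p f
    g        : Fin n → Fin q
    g-proper : Proper (co r) q g
    bound    : p + q ≤ suc n

extend : ∀ {n} (r : Rel (suc n)) → Symmetric r → ColouringPair (restrict r) → ColouringPair r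
extend {n} r r-sym (colourings p q f f-proper g g-proper bound)
  with free-or-allUsed r f | free-or-allUsed (co r) g
... | inj₁ (c , free) | _ =
  colourings p (suc q)
    (withColour f c) (withColour-proper r r-sym f f-proper c free)
    (withFresh g) (withFresh-proper (co r) g g-proper)
    (subst (_≤ suc (suc n)) (sym (+-suc p q)) (s≤s bound))
... | inj₂ _ | inj₁ (d , free) =
  colourings (suc p) q
    (withFresh f) (withFresh-proper r f f-proper)
    (withColour g d) (withColour-proper (co r) (co-symmetric r-sym) g g-proper d free)
    (s≤s bound)
... | inj₂ usedF | inj₂ usedG =
  colourings (suc p) (suc q)
    (withFresh f) (withFresh-proper r f f-proper)
    (withFresh g) (withFresh-proper (co r) g g-proper)
    (s≤s (subst (_≤ suc n) (sym (+-suc p q)) (s≤s (allUsed⇒≤ r f g usedF usedG))))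

nordhausGaddum : ∀ n (r : Rel n) → Symmetric r → ColouringPair r
nordhausGaddum zero    r _     = colourings 0 0 (λ ()) (λ ()) (λ ()) (λ ()) z≤n
nordhausGaddum (suc n) r r-sym =
  extend r r-sym (nordhausGaddum n (restrict r) (λ u v → r-sym (suc u) (suc v)))

dist2⇒distinct : ∀ {n} (G : Graph n) {u v} → Dist G u v 2 → u ≢ v
dist2⇒distinct G (_ , noShorter) refl = noShorter 0 (s≤s z≤n) []

dist2⇒nonadjacent : ∀ {n} (G : Graph n) {u v} → Dist G u v 2 → ¬ Edge G u v
dist2⇒nonadjacent G (_ , noShorter) uv = noShorter 1 (s≤s (s≤s z≤n)) (uv ∷ [])

proper⇒twoProper : ∀ {n k} (G : Graph n) (s : Rel n) →
  (∀ u v → u ≢ v → ¬ Edge G u v → T (s u v)) →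
  (f : Fin n → Fin k) → Proper s k f → TwoProper G k f
proper⇒twoProper G s covers f f-proper u v d =
  f-proper u v u≢v (covers u v u≢v (dist2⇒nonadjacent G d))
  where
  u≢v = dist2⇒distinct G d

nonadjacency-covers : ∀ {n} (G : Graph n) u v → u ≢ v → ¬ Edge G u v → T (co (adj G) u v)
nonadjacency-covers G u v _ ¬uv = ¬T⇒T-not (adj G u v) ¬uv

adjacency-covers : ∀ {n} (G : Graph n) u v → u ≢ v → ¬ Edge (complement G) u v → T (adj G u v)
adjacency-covers G u v u≢v ¬uv with u ≟ v
... | yes u≡v = ⊥-elim (u≢v u≡v)
... | no _    = ¬T-not⇒T (adj G u v) ¬uv

chi2-minimal : ∀ {n a k} (G : Graph n) → IsChi2 G a → HasTwoProperColoring G k → a ≤ k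
chi2-minimal {a = a} {k} G (_ , noFewer) colouring with a ≤? k
... | yes a≤k = a≤k
... | no a≰k  = ⊥-elim (noFewer k (≰⇒> a≰k) colouring)

colours-positive : ∀ {n k} → 1 ≤ n → (Fin n → Fin k) → 1 ≤ k
colours-positive {suc n} {zero}  _ f with f zero
... | ()
colours-positive {suc n} {suc k} _ _ = s≤s z≤n

amgm-identity : ∀ a d → 4 * (a * (a + d)) + d * d ≡ (a + (a + d)) * (a + (a + d))
amgm-identity = solve-∀

amgm-ordered : ∀ a b → a ≤ b → 4 * (a * b) ≤ (a + b) * (a + b)
amgm-ordered a b a≤b = subst (λ x → 4 * (a * x) ≤ (a + x) * (a + x)) (m+[n∸m]≡n a≤b)
  (subst (4 * (a * (a + (b ∸ a))) ≤_) (amgm-identity a (b ∸ a)) (m≤m+n _ _))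

amgm : ∀ a b → 4 * (a * b) ≤ (a + b) * (a + b)
amgm a b with ≤-total a b
... | inj₁ a≤b = amgm-ordered a b a≤b
... | inj₂ b≤a = subst₂ (λ x y → 4 * x ≤ y * y) (*-comm b a) (+-comm b a) (amgm-ordered b a b≤a)

-- Theorem 3.  With r the adjacency relation of G, Nordhaus–Gaddum yields a
-- colouring f of G, 2-proper for Ḡ, and a colouring g of Ḡ, 2-proper for G.
theorem3 : ∀ (n : ℕ) → 1 ≤ n → (G : Graph n) → (a b : ℕ) →
    IsChi2 G a → IsChi2 (complement G) b →
    (1 ≤ a * b) × ((4 * (a * b) ≤ (a + b) * (a + b)) × (a + b ≤ suc n))
theorem3 n n≥1 G a b χ₂G χ₂Ḡ = product-positive , amgm a b , sum-bound
  where
  open ColouringPair (nordhausGaddum n (adj G) (adj-sym G))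
  a≤q : a ≤ q
  a≤q = chi2-minimal G χ₂G (g , proper⇒twoProper G _ (nonadjacency-covers G) g g-proper)
  b≤p : b ≤ p
  b≤p = chi2-minimal (complement G) χ₂Ḡ
    (f , proper⇒twoProper (complement G) _ (adjacency-covers G) f f-proper)
  sum-bound : a + b ≤ suc n
  sum-bound = ≤-trans (+-mono-≤ a≤q b≤p) (subst (_≤ suc n) (+-comm p q) bound)
  product-positive : 1 ≤ a * b
  product-positive = *-mono-≤ (colours-positive n≥1 (proj₁ (proj₁ χ₂G)))
                              (colours-positive n≥1 (proj₁ (proj₁ χ₂Ḡ)))
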